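{- Let $(N,\mathcal{W})$ be a simple game without vetoers, let $N_1,\dots,N_t$ be its equivalence classes of players, $n_j=|N_j|$, and let $V\subseteq\mathbb{N}_{\ge0}^t$ be the set of minimal winning coalition vectors. Then $\nu(N,\mathcal{W})$ equals the optimal value of the integer program $$\min \sum_{v\in V}x_v\quad\text{s.t.}\quad \sum_{v=(v_1,\dots,v_t)\in V}(n_j-v_j)\,x_v\ge n_j\ \ \forall 1\le j\le t,\qquad x_v\in\mathbb{Z}_{\ge0}\ \ \forall v\in V.$$
   Context: A simple game $(N,\mathcal{W})$: $N$ finite, $\mathcal{W}$ a family of subsets of $N$ (winning coalitions) with $\emptyset\notin\mathcal{W}$, $N\in\mathcal{W}$, closed under supersets. A vetoer is a player in every winning coalition. The Nakamura number $\nu(N,\mathcal{W})$ is the minimum number of winning coalitions with empty intersection. For players $i,j$ write $i\sqsupseteq j$ if for every $S$ with $j\in S\subseteq N\setminus\{i\}$, $S\in\mathcal{W}$ implies $(S\setminus\{j\})\cup\{i\}\in\mathcal{W}$; players $i,j$ are equivalent if $i\sqsupseteq j$ and $j\sqsupseteq i$. The equivalence classes of this relation are $N_1,\dots,N_t$. The coalition vector of $S\subseteq N$ is $(|S\cap N_1|,\dots,|S\cap N_t|)$; a minimal winning coalition vector is the coalition vector of a minimal winning coalition (a winning coalition whose proper subsets are all losing). -}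

module Defs where

open import Data.Nat using (ℕ; zero; suc; _+_; _*_; _∸_; _≤_)
open import Data.Bool using (Bool; true; false; if_then_else_)
open import Data.Fin using (Fin; zero; suc)
open import Data.Fin.Subset using (Subset; inside; outside; _∈_; _∉_; _⊆_; _⊂_; _∩_; ⋂; ∣_∣; ⊥; ⊤; Empty)
open import Data.Vec using (Vec; tabulate; lookup; _[_]≔_)
open import Data.List using (List; length)
open import Data.List.Relation.Unary.All using (All)
open import Data.List.Relation.Unary.Unique.Propositional using (Unique)
open import Data.List.Membership.Propositional using () renaming (_∈_ to _∈ₗ_)
import Data.List as L
open import Data.Product using (Σ; _×_; _,_)
open import Relation.Binary.PropositionalEquality using (_≡_)
open import Relation.Nullary using (¬_; does)
open import Function.Bundles using (_⇔_)
import Data.Fin as F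

record IsSimpleGame {n : ℕ} (W : Subset n → Bool) : Set where
  field
    empty-losing : W ⊥ ≡ false
    grand-winning : W ⊤ ≡ true
    monotone : ∀ S T → S ⊆ T → W S ≡ true → W T ≡ true

Winning : ∀ {n} → (Subset n → Bool) → Subset n → Set
Winning W S = W S ≡ true

Vetoer : ∀ {n} → (Subset n → Bool) → Fin n → Set
Vetoer W i = ∀ S → Winning W S → i ∈ S

Desirable : ∀ {n} → (Subset n → Bool) → Fin n → Fin n → Set
Desirable W i j = ∀ S → j ∈ S → i ∉ S → Winning W S →
  Winning W ((S [ j ]≔ outside) [ i ]≔ inside)

Equivalent : ∀ {n} → (Subset n → Bool) → Fin n → Fin n → Set
Equivalent W i j = Desirable W i j × Desirable W j i

-- cls : Fin n → Fin t enumerates the equivalence classes N_1,…,N_t: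
-- it is surjective and two players lie in the same class iff equivalent.
record IsClassEnumeration {n : ℕ} (W : Subset n → Bool) (t : ℕ) (cls : Fin n → Fin t) : Set where
  field
    surjective : ∀ (j : Fin t) → Σ (Fin n) (λ i → cls i ≡ j)
    same-class⇔equiv : ∀ i i′ → (cls i ≡ cls i′) ⇔ Equivalent W i i′

classSet : ∀ {n t} → (Fin n → Fin t) → Fin t → Subset n
classSet cls j = tabulate (λ i → does (cls i F.≟ j))

classSize : ∀ {n t} → (Fin n → Fin t) → Fin t → ℕ
classSize cls j = ∣ classSet cls j ∣

coalitionVector : ∀ {n t} → (Fin n → Fin t) → Subset n → Vec ℕ t
coalitionVector cls S = tabulate (λ j → ∣ S ∩ classSet cls j ∣)

MinimalWinning : ∀ {n} → (Subset n → Bool) → Subset n → Set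
MinimalWinning W S = Winning W S × (∀ T → T ⊂ S → ¬ Winning W T)

MinimalWinningVector : ∀ {n t} → (Subset n → Bool) → (Fin n → Fin t) → Vec ℕ t → Set
MinimalWinningVector W cls v = Σ (Subset _) (λ S → MinimalWinning W S × coalitionVector cls S ≡ v)

IsNakamuraNumber : ∀ {n} → (Subset n → Bool) → ℕ → Set
IsNakamuraNumber W k =
  Σ (List (Subset _)) (λ Ss → All (Winning W) Ss × Empty (⋂ Ss) × length Ss ≡ k)
  × (∀ (Ss : List (Subset _)) → All (Winning W) Ss → Empty (⋂ Ss) → k ≤ length Ss)

sumFin : ∀ {m} → (Fin m → ℕ) → ℕ
sumFin {zero} f = 0
sumFin {suc m} f = f zero + sumFin (λ k → f (suc k))

-- The integer program, with V enumerated without repetition by the list Vs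
-- and the variable x_v for v = Vs[k] given by x k.
Feasible : ∀ {n t} → (Fin n → Fin t) → (Vs : List (Vec ℕ t)) → (Fin (length Vs) → ℕ) → Set
Feasible cls Vs x = ∀ (j : Fin _) →
  classSize cls j ≤ sumFin (λ k → (classSize cls j ∸ lookup (L.lookup Vs k) j) * x k)

IsIPOptimum : ∀ {n t} → (Fin n → Fin t) → List (Vec ℕ t) → ℕ → Set
IsIPOptimum cls Vs k =
  Σ (Fin (length Vs) → ℕ) (λ x → Feasible cls Vs x × sumFin x ≡ k)
  × (∀ x → Feasible cls Vs x → k ≤ sumFin x)

module Submission where

-- ν ≥ optimum: shrink each coalition of a Nakamura family to a minimal winning coalition and
-- let x_v count the coalitions with vector v.  A player of class N_j lies outside the (empty)
-- intersection, hence outside one of the minimal coalitions, so n_j ≤ Σ_v (n_j − v_j) x_v.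
--
-- ν ≤ optimum: list the vectors of a feasible x with multiplicity, v¹ … v^m with m = Σ x_v.
-- Since Σ_l (n_j − v^l_j) ≥ n_j for every class, the players can be assigned to the copies so
-- that copy l receives at most n_j − v^l_j players of N_j.  The coalition C_l of players not
-- assigned to l then meets every N_j in at least v^l_j players.  Because equivalent players can
-- be exchanged one at a time, a coalition dominating a winning coalition class by class is
-- winning; so every C_l is winning, and no player lies in all of them.
--
-- Without vetoers the winning coalitions avoiding each single player form a Nakamura family,
-- so ν exists; it is found by searching the finitely many families of each size.

open import Defs
open import Data.Bool using (Bool; true; false; not; _∧_)
open import Data.Bool.Properties using (∧-conicalʳ) renaming (_≟_ to _≟ᵇ_)
open import Data.Fin using (Fin; zero; suc; _↑ˡ_; _↑ʳ_; splitAt)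
import Data.Fin as F
import Data.Fin.Properties as Finₚ
open Finₚ using (splitAt-↑ˡ; splitAt-↑ʳ; any?)
open import Data.Fin.Subset
  using (Subset; inside; outside; _∩_; ⋂; ∣_∣; ⊤; Empty; _⊆_; _⊂_)
  renaming (_∈_ to _∈ₛ_; _∉_ to _∉ₛ_)
open import Data.Fin.Subset.Properties
  using ( _∈?_; _⊂?_; anySubset?; nonempty?; ∩-assoc; ∩-identityˡ; ⊆-trans
        ; p⊂q⇒∣p∣<∣q∣; x∈p∩q⁻)
import Data.List as L
open import Data.List using (List; []; _∷_; length)
open import Data.List.Properties using (length-tabulate)
open import Data.List.Membership.Propositional using (_∈_)
open import Data.List.Membership.Propositional.Properties using (∈-lookup)
open import Data.List.Relation.Unary.All using (All; []; _∷_)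
open import Data.List.Relation.Unary.All.Properties using (tabulate⁺; tabulate⁻)
open import Data.List.Relation.Unary.Any using (index)
open import Data.List.Relation.Unary.Any.Properties using (lookup-index)
open import Data.List.Relation.Unary.Unique.Propositional using (Unique)
open import Data.Nat using (ℕ; zero; suc; _+_; _*_; _∸_; _≤_; _<_; z≤n; s≤s; s≤s⁻¹)
open import Data.Nat.Properties hiding (≡ᵇ⇒≡)
open import Algebra.Properties.CommutativeSemigroup +-commutativeSemigroup using (interchange)
open import Data.Product using (Σ; ∃; _×_; _,_; proj₁; proj₂)
open import Data.Sum using (_⊎_; inj₁; inj₂; [_,_]′)
open import Data.Vec using (Vec; []; _∷_; lookup; tabulate; _[_]≔_)
open import Data.Vec.Properties
  using ( []=⇒lookup; lookup⇒[]=; lookup∘tabulate; lookup-zipWith; lookup-replicate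
        ; lookup∘update; lookup∘update′)
open import Data.Vec.Functional using (updateAt)
open import Data.Vec.Functional.Properties using (updateAt-updates; updateAt-minimal)
open import Function using (_∘_)
open import Function.Bundles using (_⇔_; Equivalence)
open import Relation.Binary.PropositionalEquality
open import Relation.Nullary using (¬_; Dec; does; yes; no; contradiction)
open import Relation.Nullary.Decidable using (dec-true; dec-false; decidable-stable; _×-dec_; ¬?)

sumFin-cong : ∀ {m} {f g : Fin m → ℕ} → (∀ k → f k ≡ g k) → sumFin f ≡ sumFin g
sumFin-cong {zero} f≗g = refl
sumFin-cong {suc m} f≗g = cong₂ _+_ (f≗g zero) (sumFin-cong (f≗g ∘ suc))

sumFin-mono : ∀ {m} {f g : Fin m → ℕ} → (∀ k → f k ≤ g k) → sumFin f ≤ sumFin g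
sumFin-mono {zero} f≤g = z≤n
sumFin-mono {suc m} f≤g = +-mono-≤ (f≤g zero) (sumFin-mono (f≤g ∘ suc))

sumFin-mono-< : ∀ {m} {f g : Fin m → ℕ} → (∀ k → f k ≤ g k) → ∀ a → f a < g a →
  sumFin f < sumFin g
sumFin-mono-< {suc m} f≤g zero fa<ga = +-mono-<-≤ fa<ga (sumFin-mono (f≤g ∘ suc))
sumFin-mono-< {suc m} f≤g (suc a) fa<ga = +-mono-≤-< (f≤g zero) (sumFin-mono-< (f≤g ∘ suc) a fa<ga)

sumFin-+ : ∀ {m} (f g : Fin m → ℕ) → sumFin (λ k → f k + g k) ≡ sumFin f + sumFin g
sumFin-+ {zero} f g = refl
sumFin-+ {suc m} f g = begin
  f zero + g zero + sumFin (λ k → f (suc k) + g (suc k))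
    ≡⟨ cong (f zero + g zero +_) (sumFin-+ (f ∘ suc) (g ∘ suc)) ⟩
  f zero + g zero + (sumFin (f ∘ suc) + sumFin (g ∘ suc))
    ≡⟨ interchange (f zero) (g zero) _ _ ⟩
  f zero + sumFin (f ∘ suc) + (g zero + sumFin (g ∘ suc)) ∎
  where open ≡-Reasoning

sumFin-∸ : ∀ {m} {f g : Fin m → ℕ} → (∀ k → g k ≤ f k) →
  sumFin f ≡ sumFin (λ k → f k ∸ g k) + sumFin g
sumFin-∸ {f = f} {g} g≤f =
  trans (sumFin-cong (λ k → sym (m∸n+n≡m (g≤f k)))) (sumFin-+ (λ k → f k ∸ g k) g)

sumFin-const : ∀ m c → sumFin {m} (λ _ → c) ≡ c * m
sumFin-const zero c = sym (*-zeroʳ c)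
sumFin-const (suc m) c = trans (cong (c +_) (sumFin-const m c)) (sym (*-suc c m))

sumFin-splitAt : ∀ a {b} (g : Fin (a + b) → ℕ) →
  sumFin g ≡ sumFin (g ∘ (_↑ˡ b)) + sumFin (g ∘ (a ↑ʳ_))
sumFin-splitAt zero g = refl
sumFin-splitAt (suc a) g =
  trans (cong (g zero +_) (sumFin-splitAt a (g ∘ suc))) (sym (+-assoc (g zero) _ _))

sumFin-positive : ∀ {m} (f : Fin m → ℕ) → 0 < sumFin f → ∃ λ k → 0 < f k
sumFin-positive {suc m} f 0<Σf with f zero in f0≡
... | suc _ = zero , subst (0 <_) (sym f0≡) (s≤s z≤n)
... | zero with sumFin-positive (f ∘ suc) 0<Σf
...   | k , 0<fk = suc k , 0<fk

sumFin-update : ∀ {m} (f g : Fin m → ℕ) a → (∀ k → k ≢ a → g k ≡ f k) →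
  sumFin g + f a ≡ sumFin f + g a
sumFin-update {suc m} f g zero g≗f = begin
  g zero + sumFin (g ∘ suc) + f zero
    ≡⟨ cong (λ s → g zero + s + f zero) (sumFin-cong (λ k → g≗f (suc k) (λ ()))) ⟩
  g zero + sumFin (f ∘ suc) + f zero
    ≡⟨ +-comm (g zero + _) (f zero) ⟩
  f zero + (g zero + sumFin (f ∘ suc))
    ≡⟨ cong (f zero +_) (+-comm (g zero) _) ⟩
  f zero + (sumFin (f ∘ suc) + g zero)
    ≡⟨ +-assoc (f zero) _ _ ⟨
  f zero + sumFin (f ∘ suc) + g zero ∎
  where open ≡-Reasoning
sumFin-update {suc m} f g (suc a) g≗f = begin
  g zero + sumFin (g ∘ suc) + f (suc a)
    ≡⟨ +-assoc (g zero) _ _ ⟩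
  g zero + (sumFin (g ∘ suc) + f (suc a))
    ≡⟨ cong₂ _+_ (g≗f zero (λ ())) (sumFin-update (f ∘ suc) (g ∘ suc) a g∘suc≗f∘suc) ⟩
  f zero + (sumFin (f ∘ suc) + g (suc a))
    ≡⟨ +-assoc (f zero) _ _ ⟨
  f zero + sumFin (f ∘ suc) + g (suc a) ∎
  where
  open ≡-Reasoning
  g∘suc≗f∘suc : ∀ k → k ≢ a → g (suc k) ≡ f (suc k)
  g∘suc≗f∘suc k k≢a = g≗f (suc k) (k≢a ∘ Finₚ.suc-injective)

sumFin-exchange : ∀ {m} (f g : Fin m → ℕ) {i j} → i ≢ j →
  (∀ k → k ≢ i → k ≢ j → g k ≡ f k) → g i ≡ f j → g j ≡ f i → sumFin g ≡ sumFin f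
sumFin-exchange f g {i} {j} i≢j g≗f gi≡fj gj≡fi = +-cancelʳ-≡ (f j) _ _ (begin
  sumFin g + f j ≡⟨ cong (sumFin g +_) (updateAt-minimal j i f (i≢j ∘ sym)) ⟨
  sumFin g + h j ≡⟨ sumFin-update h g j g≗h ⟩
  sumFin h + g j ≡⟨ cong (sumFin h +_) gj≡fi ⟩
  sumFin h + f i ≡⟨ sumFin-update f h i (λ k k≢i → updateAt-minimal k i f k≢i) ⟩
  sumFin f + h i ≡⟨ cong (sumFin f +_) (trans (updateAt-updates i f) gi≡fj) ⟩
  sumFin f + f j ∎)
  where
  open ≡-Reasoning
  h : Fin _ → ℕ
  h = updateAt f i (λ _ → g i)
  g≗h : ∀ k → k ≢ j → g k ≡ h k
  g≗h k k≢j with k F.≟ i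
  ... | yes refl = sym (updateAt-updates i f)
  ... | no k≢i = trans (g≗f k k≢i k≢j) (sym (updateAt-minimal k i f k≢i))

_≡ᵇ_ : ∀ {m} → Fin m → Fin m → Bool
a ≡ᵇ b = does (a F.≟ b)

≡ᵇ-refl : ∀ {m} (a : Fin m) → a ≡ᵇ a ≡ true
≡ᵇ-refl a = dec-true (a F.≟ a) refl

≡ᵇ⇒≡ : ∀ {m} {a b : Fin m} → a ≡ᵇ b ≡ true → a ≡ b
≡ᵇ⇒≡ {a = a} {b} a≡ᵇb with a F.≟ b | a≡ᵇb
... | yes a≡b | _ = a≡b
... | no _ | ()

≢⇒≡ᵇ-false : ∀ {m} {a b : Fin m} → a ≢ b → a ≡ᵇ b ≡ false
≢⇒≡ᵇ-false {a = a} {b} = dec-false (a F.≟ b)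

χ : Bool → ℕ
χ true = 1
χ false = 0

χ-∧ : ∀ a b → χ (a ∧ b) ≡ χ a * χ b
χ-∧ true b = sym (+-identityʳ (χ b))
χ-∧ false b = refl

sumFin-δ : ∀ {m} (a : Fin m) (c : Fin m → ℕ) → sumFin (λ k → c k * χ (a ≡ᵇ k)) ≡ c a
sumFin-δ {m} a c = begin
  sumFin (λ k → c k * χ (a ≡ᵇ k))
    ≡⟨ +-identityʳ _ ⟨
  sumFin (λ k → c k * χ (a ≡ᵇ k)) + 0
    ≡⟨ sumFin-update (λ _ → 0) (λ k → c k * χ (a ≡ᵇ k)) a vanishes-off-a ⟩
  sumFin {m} (λ _ → 0) + c a * χ (a ≡ᵇ a)
    ≡⟨ cong₂ (λ s b → s + c a * χ b) (sumFin-const m 0) (≡ᵇ-refl a) ⟩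
  c a * 1
    ≡⟨ *-identityʳ (c a) ⟩
  c a ∎
  where
  open ≡-Reasoning
  vanishes-off-a : ∀ k → k ≢ a → c k * χ (a ≡ᵇ k) ≡ 0
  vanishes-off-a k k≢a = trans (cong (λ b → c k * χ b) (≢⇒≡ᵇ-false (k≢a ∘ sym))) (*-zeroʳ (c k))

sumFin-χ≡ᵇ : ∀ {m} (a : Fin m) → sumFin (λ k → χ (a ≡ᵇ k)) ≡ 1
sumFin-χ≡ᵇ a = trans (sumFin-cong (λ k → sym (*-identityˡ (χ (a ≡ᵇ k))))) (sumFin-δ a (λ _ → 1))

sumFin-*-χ≡ᵇ-+ : ∀ {m} (c x : Fin m → ℕ) a →
  sumFin (λ k → c k * (χ (a ≡ᵇ k) + x k)) ≡ c a + sumFin (λ k → c k * x k)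
sumFin-*-χ≡ᵇ-+ c x a = begin
  sumFin (λ k → c k * (χ (a ≡ᵇ k) + x k))
    ≡⟨ sumFin-cong (λ k → *-distribˡ-+ (c k) (χ (a ≡ᵇ k)) (x k)) ⟩
  sumFin (λ k → c k * χ (a ≡ᵇ k) + c k * x k)
    ≡⟨ sumFin-+ (λ k → c k * χ (a ≡ᵇ k)) (λ k → c k * x k) ⟩
  sumFin (λ k → c k * χ (a ≡ᵇ k)) + sumFin (λ k → c k * x k)
    ≡⟨ cong (_+ sumFin (λ k → c k * x k)) (sumFin-δ a c) ⟩
  c a + sumFin (λ k → c k * x k) ∎
  where open ≡-Reasoning

-- Entry l of the list 0 … 0 1 … 1 … in which each k occurs x k times.
replicateIndex : ∀ {m} (x : Fin m → ℕ) → Fin (sumFin x) → Fin m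
replicateIndex {suc m} x l = [ (λ _ → zero) , suc ∘ replicateIndex (x ∘ suc) ]′ (splitAt (x zero) l)

sumFin-replicateIndex : ∀ {m} (x f : Fin m → ℕ) →
  sumFin (f ∘ replicateIndex x) ≡ sumFin (λ k → f k * x k)
sumFin-replicateIndex {zero} x f = refl
sumFin-replicateIndex {suc m} x f = begin
  sumFin (f ∘ replicateIndex x)
    ≡⟨ sumFin-splitAt (x zero) (f ∘ replicateIndex x) ⟩
  sumFin (f ∘ replicateIndex x ∘ (_↑ˡ rest)) + sumFin (f ∘ replicateIndex x ∘ (x zero ↑ʳ_))
    ≡⟨ cong₂ _+_ (sumFin-cong first-block) (sumFin-cong later-blocks) ⟩
  sumFin {x zero} (λ _ → f zero) + sumFin (f ∘ suc ∘ replicateIndex (x ∘ suc))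
    ≡⟨ cong₂ _+_ (sumFin-const (x zero) (f zero)) (sumFin-replicateIndex (x ∘ suc) (f ∘ suc)) ⟩
  f zero * x zero + sumFin (λ k → f (suc k) * x (suc k)) ∎
  where
  open ≡-Reasoning
  rest = sumFin (x ∘ suc)
  first-block : ∀ l → f (replicateIndex x (l ↑ˡ rest)) ≡ f zero
  first-block l rewrite splitAt-↑ˡ (x zero) l rest = refl
  later-blocks : ∀ l → f (replicateIndex x (x zero ↑ʳ l)) ≡ f (suc (replicateIndex (x ∘ suc) l))
  later-blocks l rewrite splitAt-↑ʳ (x zero) rest l = refl

count : ∀ {n} → (Fin n → Bool) → ℕ
count f = sumFin (χ ∘ f)

count-mono : ∀ {n} {f g : Fin n → Bool} → (∀ i → f i ≡ true → g i ≡ true) → count f ≤ count g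
count-mono {f = f} {g} f⇒g = sumFin-mono χ-mono
  where
  χ-mono : ∀ i → χ (f i) ≤ χ (g i)
  χ-mono i with f i | f⇒g i
  ... | true | fi⇒gi rewrite fi⇒gi refl = ≤-refl
  ... | false | _ = z≤n

count-split : ∀ {n} (f g : Fin n → Bool) →
  count g ≡ count (λ i → f i ∧ g i) + count (λ i → not (f i) ∧ g i)
count-split f g = trans (sumFin-cong (λ i → χ-split (f i) (g i)))
                        (sumFin-+ (λ i → χ (f i ∧ g i)) (λ i → χ (not (f i) ∧ g i)))
  where
  χ-split : ∀ a b → χ b ≡ χ (a ∧ b) + χ (not a ∧ b)
  χ-split true b = sym (+-identityʳ (χ b))
  χ-split false b = refl

∣p∣≡count : ∀ {n} (p : Subset n) → ∣ p ∣ ≡ count (lookup p)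
∣p∣≡count [] = refl
∣p∣≡count (true ∷ p) = cong suc (∣p∣≡count p)
∣p∣≡count (false ∷ p) = ∣p∣≡count p

∈⇒lookup : ∀ {n} {p : Subset n} {i} → i ∈ₛ p → lookup p i ≡ true
∈⇒lookup = []=⇒lookup

lookup⇒∈ : ∀ {n} {p : Subset n} {i} → lookup p i ≡ true → i ∈ₛ p
lookup⇒∈ {p = p} {i} = lookup⇒[]= i p

∉⇒lookup : ∀ {n} {p : Subset n} {i} → i ∉ₛ p → lookup p i ≡ false
∉⇒lookup {p = p} {i} i∉p with lookup p i in p[i]
... | true = contradiction (lookup⇒∈ p[i]) i∉p
... | false = refl

lookup-∩ : ∀ {n} (p q : Subset n) i → lookup (p ∩ q) i ≡ lookup p i ∧ lookup q i
lookup-∩ p q i = lookup-zipWith _∧_ i p q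

∈⋂⇒All : ∀ {n} (Ss : List (Subset n)) {i} → i ∈ₛ ⋂ Ss → All (i ∈ₛ_) Ss
∈⋂⇒All [] _ = []
∈⋂⇒All (S ∷ Ss) i∈S∩⋂Ss =
  let i∈S , i∈⋂Ss = x∈p∩q⁻ S (⋂ Ss) i∈S∩⋂Ss in i∈S ∷ ∈⋂⇒All Ss i∈⋂Ss

module _ {n t} (cls : Fin n → Fin t) where

  present : Subset n → Fin t → ℕ
  present S j = count (λ i → lookup S i ∧ cls i ≡ᵇ j)

  absent : Subset n → Fin t → ℕ
  absent S j = count (λ i → not (lookup S i) ∧ cls i ≡ᵇ j)

  classSize≡count : ∀ j → classSize cls j ≡ count (λ i → cls i ≡ᵇ j)
  classSize≡count j = trans (∣p∣≡count (classSet cls j))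
    (sumFin-cong (λ i → cong χ (lookup∘tabulate (λ i → cls i ≡ᵇ j) i)))

  coalitionVector≡present : ∀ S j → lookup (coalitionVector cls S) j ≡ present S j
  coalitionVector≡present S j = begin
    lookup (coalitionVector cls S) j    ≡⟨ lookup∘tabulate (λ j → ∣ S ∩ classSet cls j ∣) j ⟩
    ∣ S ∩ classSet cls j ∣              ≡⟨ ∣p∣≡count (S ∩ classSet cls j) ⟩
    count (lookup (S ∩ classSet cls j)) ≡⟨ sumFin-cong (λ i → cong χ (lookup-S∩class i)) ⟩
    present S j                         ∎
    where
    open ≡-Reasoning
    lookup-S∩class : ∀ i → lookup (S ∩ classSet cls j) i ≡ lookup S i ∧ cls i ≡ᵇ j
    lookup-S∩class i = trans (lookup-∩ S (classSet cls j) i)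
      (cong (lookup S i ∧_) (lookup∘tabulate (λ i → cls i ≡ᵇ j) i))

  classSize≡present+absent : ∀ S j → classSize cls j ≡ present S j + absent S j
  classSize≡present+absent S j = trans (classSize≡count j) (count-split (lookup S) (λ i → cls i ≡ᵇ j))

  present≤classSize : ∀ S j → present S j ≤ classSize cls j
  present≤classSize S j = subst (present S j ≤_) (sym (classSize≡present+absent S j)) (m≤m+n _ _)

  present-tabulate : ∀ (f : Fin n → Bool) j →
    present (tabulate f) j ≡ count (λ i → f i ∧ cls i ≡ᵇ j)
  present-tabulate f j = sumFin-cong (λ i → cong (λ b → χ (b ∧ cls i ≡ᵇ j)) (lookup∘tabulate f i))

  absent-⊤ : ∀ j → absent ⊤ j ≡ 0
  absent-⊤ j =
    trans (sumFin-cong (λ i → cong (λ b → χ (not b ∧ cls i ≡ᵇ j)) (lookup-replicate i true)))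
          (sumFin-const n 0)

  absent-Empty : ∀ {S} → Empty S → ∀ j → absent S j ≡ classSize cls j
  absent-Empty {S} S-empty j = trans (sumFin-cong outside-S) (sym (classSize≡count j))
    where
    outside-S : ∀ i → χ (not (lookup S i) ∧ cls i ≡ᵇ j) ≡ χ (cls i ≡ᵇ j)
    outside-S i = cong (λ b → χ (not b ∧ cls i ≡ᵇ j)) (∉⇒lookup (λ i∈S → S-empty (i , i∈S)))

  absent-antitone : ∀ {M S} → M ⊆ S → ∀ j → absent S j ≤ absent M j
  absent-antitone {M} {S} M⊆S j = count-mono outside-S⇒outside-M
    where
    outside-S⇒outside-M : ∀ i → not (lookup S i) ∧ cls i ≡ᵇ j ≡ true →
                                not (lookup M i) ∧ cls i ≡ᵇ j ≡ true
    outside-S⇒outside-M i with lookup M i in M[i]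
    ... | false = ∧-conicalʳ _ _
    ... | true rewrite ∈⇒lookup (M⊆S (lookup⇒∈ M[i])) = λ ()

  absent-∩ : ∀ S R j → absent (S ∩ R) j ≤ absent S j + absent R j
  absent-∩ S R j = subst (absent (S ∩ R) j ≤_) (sumFin-+ (outsider S) (outsider R)) (sumFin-mono χ-∩)
    where
    outsider : Subset n → Fin n → ℕ
    outsider X i = χ (not (lookup X i) ∧ cls i ≡ᵇ j)
    χ-∩ : ∀ i → outsider (S ∩ R) i ≤ outsider S i + outsider R i
    χ-∩ i rewrite lookup-∩ S R i with lookup S i | lookup R i
    ... | true  | true  = z≤n
    ... | true  | false = ≤-refl
    ... | false | _     = m≤m+n _ _

  deficit : Fin t → Vec ℕ t → ℕ
  deficit j v = classSize cls j ∸ lookup v j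

  deficitSum : (Vs : List (Vec ℕ t)) → (Fin (length Vs) → ℕ) → Fin t → ℕ
  deficitSum Vs x j = sumFin (λ k → deficit j (L.lookup Vs k) * x k)

  deficit-coalitionVector : ∀ S j → deficit j (coalitionVector cls S) ≡ absent S j
  deficit-coalitionVector S j = begin
    classSize cls j ∸ lookup (coalitionVector cls S) j
      ≡⟨ cong₂ _∸_ (classSize≡present+absent S j) (coalitionVector≡present S j) ⟩
    present S j + absent S j ∸ present S j
      ≡⟨ m+n∸m≡n (present S j) (absent S j) ⟩
    absent S j ∎
    where open ≡-Reasoning

  exchange : Fin n → Fin n → Subset n → Subset n
  exchange i j S = (S [ j ]≔ outside) [ i ]≔ inside

  lookup-exchange-in : ∀ i j S → lookup (exchange i j S) i ≡ true
  lookup-exchange-in i j S = lookup∘update i (S [ j ]≔ outside) inside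

  lookup-exchange-out : ∀ {i j} S → i ≢ j → lookup (exchange i j S) j ≡ false
  lookup-exchange-out {i} {j} S i≢j =
    trans (lookup∘update′ (i≢j ∘ sym) (S [ j ]≔ outside) inside) (lookup∘update j S outside)

  lookup-exchange-other : ∀ {i j k} S → k ≢ i → k ≢ j → lookup (exchange i j S) k ≡ lookup S k
  lookup-exchange-other {i} {j} S k≢i k≢j =
    trans (lookup∘update′ k≢i (S [ j ]≔ outside) inside) (lookup∘update′ k≢j S outside)

  present-exchange : ∀ {i j S} → i ∉ₛ S → j ∈ₛ S → cls i ≡ cls j →
    ∀ c → present (exchange i j S) c ≡ present S c
  present-exchange {i} {j} {S} i∉S j∈S same-class c =
    sumFin-exchange (member S) (member (exchange i j S)) i≢j
      (λ k k≢i k≢j → cong (λ b → χ (b ∧ cls k ≡ᵇ c)) (lookup-exchange-other S k≢i k≢j))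
      (cong₂ (λ b d → χ (b ∧ d ≡ᵇ c))
             (trans (lookup-exchange-in i j S) (sym (∈⇒lookup j∈S))) same-class)
      (trans (cong (λ b → χ (b ∧ cls j ≡ᵇ c)) (lookup-exchange-out S i≢j))
             (cong (λ b → χ (b ∧ cls i ≡ᵇ c)) (sym (∉⇒lookup i∉S))))
    where
    member : Subset n → Fin n → ℕ
    member X k = χ (lookup X k ∧ cls k ≡ᵇ c)
    i≢j : i ≢ j
    i≢j refl = i∉S j∈S

  excess : Subset n → Subset n → ℕ
  excess T S = count (λ k → lookup S k ∧ not (lookup T k))

  excess-exchange : ∀ {i j S T} → i ∈ₛ T → j ∈ₛ S → j ∉ₛ T →
    excess T (exchange i j S) < excess T S
  excess-exchange {i} {j} {S} {T} i∈T j∈S j∉T = sumFin-mono-< pointwise j at-j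
    where
    i≢j : i ≢ j
    i≢j refl = j∉T i∈T
    outsider : Subset n → Fin n → ℕ
    outsider X k = χ (lookup X k ∧ not (lookup T k))
    pointwise : ∀ k → outsider (exchange i j S) k ≤ outsider S k
    pointwise k with k F.≟ i | k F.≟ j
    ... | yes refl | _ rewrite lookup-exchange-in i j S | ∈⇒lookup i∈T = z≤n
    ... | no _ | yes refl rewrite lookup-exchange-out S i≢j = z≤n
    ... | no k≢i | no k≢j rewrite lookup-exchange-other S k≢i k≢j = ≤-refl
    at-j : outsider (exchange i j S) j < outsider S j
    at-j rewrite lookup-exchange-out S i≢j | ∈⇒lookup j∈S | ∉⇒lookup j∉T = s≤s z≤n

  present-without-partner : ∀ {j S T} → j ∈ₛ S → j ∉ₛ T →
    (∀ i → i ∈ₛ T → cls i ≡ cls j → i ∈ₛ S) → present T (cls j) < present S (cls j)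
  present-without-partner {j} {S} {T} j∈S j∉T partnerless = sumFin-mono-< pointwise j at-j
    where
    member : Subset n → Fin n → ℕ
    member X k = χ (lookup X k ∧ cls k ≡ᵇ cls j)
    pointwise : ∀ k → member T k ≤ member S k
    pointwise k with lookup T k in T[k] | cls k ≡ᵇ cls j in same-class
    ... | false | _ = z≤n
    ... | true | false = z≤n
    ... | true | true rewrite ∈⇒lookup (partnerless k (lookup⇒∈ T[k]) (≡ᵇ⇒≡ same-class)) = ≤-refl
    at-j : member T j < member S j
    at-j rewrite ∈⇒lookup j∈S | ∉⇒lookup j∉T | ≡ᵇ-refl (cls j) = s≤s z≤n

-- Greedily: player zero takes one unit of capacity of its class from a bin that has room.
assignWithinCapacity : ∀ {n t m} (cl : Fin n → Fin t) (cap : Fin m → Fin t → ℕ) →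
  (∀ j → count (λ i → cl i ≡ᵇ j) ≤ sumFin (λ l → cap l j)) →
  Σ (Fin n → Fin m) λ h → ∀ l j → count (λ i → h i ≡ᵇ l ∧ cl i ≡ᵇ j) ≤ cap l j
assignWithinCapacity {zero} cl cap enough = (λ ()) , λ _ _ → z≤n
assignWithinCapacity {suc n} {t} {m} cl cap enough = h , within
  where
  c = cl zero
  room : ∃ λ l → 0 < cap l c
  room = sumFin-positive (λ l → cap l c) (≤-trans 0<count (enough c))
    where
    0<count : 0 < χ (c ≡ᵇ c) + count (λ i → cl (suc i) ≡ᵇ c)
    0<count rewrite ≡ᵇ-refl c = s≤s z≤n
  l₀ = proj₁ room
  δ : Fin m → Fin t → ℕ
  δ l j = χ (l₀ ≡ᵇ l ∧ c ≡ᵇ j)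
  δ≤cap : ∀ l j → δ l j ≤ cap l j
  δ≤cap l j with l₀ ≡ᵇ l in l₀≡l | c ≡ᵇ j in c≡j
  ... | true | true = subst₂ (λ l j → 0 < cap l j) (≡ᵇ⇒≡ l₀≡l) (≡ᵇ⇒≡ c≡j) (proj₂ room)
  ... | true | false = z≤n
  ... | false | _ = z≤n
  cap′ : Fin m → Fin t → ℕ
  cap′ l j = cap l j ∸ δ l j
  cap-split : ∀ j → sumFin (λ l → cap l j) ≡ sumFin (λ l → cap′ l j) + χ (c ≡ᵇ j)
  cap-split j = trans (sumFin-∸ (λ l → δ≤cap l j)) (cong (sumFin (λ l → cap′ l j) +_) Σδ)
    where
    Σδ : sumFin (λ l → δ l j) ≡ χ (c ≡ᵇ j)
    Σδ = trans (sumFin-cong (λ l → trans (χ-∧ (l₀ ≡ᵇ l) (c ≡ᵇ j)) (*-comm (χ (l₀ ≡ᵇ l)) _)))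
               (sumFin-δ l₀ (λ _ → χ (c ≡ᵇ j)))
  enough′ : ∀ j → count (λ i → cl (suc i) ≡ᵇ j) ≤ sumFin (λ l → cap′ l j)
  enough′ j = +-cancelʳ-≤ (χ (c ≡ᵇ j)) _ _ (begin
    count (λ i → cl (suc i) ≡ᵇ j) + χ (c ≡ᵇ j) ≡⟨ +-comm _ (χ (c ≡ᵇ j)) ⟩
    count (λ i → cl i ≡ᵇ j)                    ≤⟨ enough j ⟩
    sumFin (λ l → cap l j)                     ≡⟨ cap-split j ⟩
    sumFin (λ l → cap′ l j) + χ (c ≡ᵇ j)       ∎)
    where open ≤-Reasoning
  rest = assignWithinCapacity (cl ∘ suc) cap′ enough′
  h : Fin (suc n) → Fin m
  h zero = l₀
  h (suc i) = proj₁ rest i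
  within : ∀ l j → count (λ i → h i ≡ᵇ l ∧ cl i ≡ᵇ j) ≤ cap l j
  within l j = subst (δ l j + count (λ i → proj₁ rest i ≡ᵇ l ∧ cl (suc i) ≡ᵇ j) ≤_)
                 (trans (+-comm (δ l j) (cap′ l j)) (m∸n+n≡m (δ≤cap l j)))
                 (+-monoʳ-≤ (δ l j) (proj₂ rest l j))

least : ∀ {P : ℕ → Set} → (∀ k → Dec (P k)) → ∀ {b} → P b →
  Σ ℕ λ k → P k × (∀ k′ → P k′ → k ≤ k′)
least {P} P? {b} Pb with search (suc b)
  where
  search : ∀ b → (Σ ℕ λ k → P k × (∀ k′ → P k′ → k ≤ k′)) ⊎ (∀ k → k < b → ¬ P k)
  search zero = inj₂ (λ _ ())
  search (suc b) with search b
  ... | inj₁ found = inj₁ found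
  ... | inj₂ none-below-b with P? b
  ...   | yes Pb = inj₁ (b , Pb , λ k′ Pk′ → ≮⇒≥ (λ k′<b → none-below-b k′ k′<b Pk′))
  ...   | no ¬Pb = inj₂ (λ k k<1+b →
    [ none-below-b k , (λ { refl → ¬Pb }) ]′ (m<1+n⇒m<n∨m≡n k<1+b))
... | inj₁ found = found
... | inj₂ none = contradiction Pb (none b ≤-refl)

module _ {n} (W : Subset n → Bool) where

  NakamuraFamily : ℕ → Set
  NakamuraFamily k = Σ (List (Subset n)) λ Ss → All (Winning W) Ss × Empty (⋂ Ss) × length Ss ≡ k

  -- Generalised over the intersection acc of the coalitions chosen so far.
  familyWithin? : ∀ k acc →
    Dec (Σ (List (Subset n)) λ Ss → length Ss ≡ k × All (Winning W) Ss × Empty (acc ∩ ⋂ Ss))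
  familyWithin? zero acc with nonempty? (acc ∩ ⊤)
  ... | yes acc-nonempty = no λ { ([] , _ , _ , acc-empty) → acc-empty acc-nonempty }
  ... | no acc-empty = yes ([] , refl , [] , acc-empty)
  familyWithin? (suc k) acc
    with anySubset? {P = λ S → Winning W S × _} (λ S → W S ≟ᵇ true ×-dec familyWithin? k (acc ∩ S))
  ... | yes (S , S-wins , Ss , refl , Ss-win , empty) =
    yes (S ∷ Ss , refl , S-wins ∷ Ss-win , subst Empty (∩-assoc acc S (⋂ Ss)) empty)
  ... | no none = no λ { (S ∷ Ss , refl , S-wins ∷ Ss-win , empty) →
    none (S , S-wins , Ss , refl , Ss-win , subst Empty (sym (∩-assoc acc S (⋂ Ss))) empty) }

  nakamuraFamily? : ∀ k → Dec (NakamuraFamily k)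
  nakamuraFamily? k with familyWithin? k ⊤
  ... | yes (Ss , len , Ss-win , empty) =
    yes (Ss , Ss-win , subst Empty (∩-identityˡ (⋂ Ss)) empty , len)
  ... | no none = no λ { (Ss , Ss-win , empty , len) →
    none (Ss , len , Ss-win , subst Empty (sym (∩-identityˡ (⋂ Ss))) empty) }

  vetoless⇒nakamuraFamily : (∀ i → ¬ Vetoer W i) → NakamuraFamily n
  vetoless⇒nakamuraFamily no-vetoer =
    L.tabulate S , tabulate⁺ (proj₁ ∘ proj₂ ∘ avoiding) , disjoint , length-tabulate S
    where
    avoiding : ∀ i → Σ (Subset n) λ S → Winning W S × i ∉ₛ S
    avoiding i
      with anySubset? {P = λ S → Winning W S × i ∉ₛ S} (λ S → W S ≟ᵇ true ×-dec ¬? (i ∈? S))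
    ... | yes found = found
    ... | no none = contradiction
      (λ S S-wins → decidable-stable (i ∈? S) (λ i∉S → none (S , S-wins , i∉S))) (no-vetoer i)
    S : Fin n → Subset n
    S i = proj₁ (avoiding i)
    disjoint : Empty (⋂ (L.tabulate S))
    disjoint (i , i∈⋂S) = proj₂ (proj₂ (avoiding i)) (tabulate⁻ (∈⋂⇒All (L.tabulate S) i∈⋂S) i)

module _ {n} {W : Subset n → Bool} (G : IsSimpleGame W) where
  open IsSimpleGame G

  minimalWinningSubset : ∀ S → Winning W S → Σ (Subset n) λ M → M ⊆ S × MinimalWinning W M
  minimalWinningSubset S = shrink (suc ∣ S ∣) S ≤-refl
    where
    shrink : ∀ k S → ∣ S ∣ < k → Winning W S → Σ (Subset n) λ M → M ⊆ S × MinimalWinning W M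
    shrink (suc k) S |S|<1+k S-wins
      with anySubset? {P = λ T → T ⊂ S × Winning W T} (λ T → T ⊂? S ×-dec W T ≟ᵇ true)
    ... | yes (T , T⊂S , T-wins) =
      let M , M⊆T , M-minimal = shrink k T (≤-trans (p⊂q⇒∣p∣<∣q∣ T⊂S) (s≤s⁻¹ |S|<1+k)) T-wins
      in M , ⊆-trans M⊆T (proj₁ T⊂S) , M-minimal
    ... | no no-smaller = S , (λ i∈S → i∈S) , S-wins , λ T T⊂S T-wins → no-smaller (T , T⊂S , T-wins)

  module _ {t} {cls : Fin n → Fin t} (E : IsClassEnumeration W t cls) where
    open IsClassEnumeration E

    -- Induction on |S ∖ T|: a player of S ∖ T is exchanged for an equivalent one of T ∖ S, and if
    -- there is none, S has more players than T in that class.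
    winning-dominated : ∀ S T → Winning W S → (∀ c → present cls S c ≤ present cls T c) →
      Winning W T
    winning-dominated S T = descend (suc (excess cls T S)) S ≤-refl
      where
      descend : ∀ k S → excess cls T S < k → Winning W S →
        (∀ c → present cls S c ≤ present cls T c) → Winning W T
      descend (suc k) S S∖T<1+k S-wins S≤T with any? (λ j → j ∈? S ×-dec ¬? (j ∈? T))
      ... | no S⊆T =
        monotone S T (λ {j} j∈S → decidable-stable (j ∈? T) (λ j∉T → S⊆T (j , j∈S , j∉T))) S-wins
      ... | yes (j , j∈S , j∉T) with any? (λ i → i ∈? T ×-dec ¬? (i ∈? S) ×-dec cls i F.≟ cls j)
      ...   | yes (i , i∈T , i∉S , same-class) =
        descend k (exchange cls i j S)
          (≤-trans (excess-exchange cls i∈T j∈S j∉T) (s≤s⁻¹ S∖T<1+k))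
          (proj₁ (Equivalence.to (same-class⇔equiv i j) same-class) S j∈S i∉S S-wins)
          (λ c → subst (_≤ present cls T c)
                       (sym (present-exchange cls i∉S j∈S same-class c)) (S≤T c))
      ...   | no no-partner = contradiction (S≤T (cls j)) (<⇒≱ fewer)
        where
        partnerless : ∀ i → i ∈ₛ T → cls i ≡ cls j → i ∈ₛ S
        partnerless i i∈T same-class =
          decidable-stable (i ∈? S) (λ i∉S → no-partner (i , i∈T , i∉S , same-class))
        fewer : present cls T (cls j) < present cls S (cls j)
        fewer = present-without-partner cls j∈S j∉T partnerless

  module _ {t} (cls : Fin n → Fin t) (Vs : List (Vec ℕ t))
           (Vs-minimal : ∀ v → (v ∈ Vs) ⇔ MinimalWinningVector W cls v) where

    -- x counts the vectors of minimal winning coalitions M_S ⊆ S, one for each S in the family.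
    minimalVectorCounts : ∀ Ss → All (Winning W) Ss → Σ (Fin (length Vs) → ℕ) λ x →
      sumFin x ≡ length Ss × (∀ j → absent cls (⋂ Ss) j ≤ deficitSum cls Vs x j)
    minimalVectorCounts [] [] = (λ _ → 0) , sumFin-const (length Vs) 0 ,
      λ j → subst (_≤ deficitSum cls Vs (λ _ → 0) j) (sym (absent-⊤ cls j)) z≤n
    minimalVectorCounts (S ∷ Ss) (S-wins ∷ Ss-win) with minimalWinningSubset S S-wins
    ... | M , M⊆S , M-minimal with minimalVectorCounts Ss Ss-win
    ...   | x , Σx , bound = x′ , Σx′ , bound′
      where
      v∈Vs : coalitionVector cls M ∈ Vs
      v∈Vs = Equivalence.from (Vs-minimal _) (M , M-minimal , refl)
      a = index v∈Vs
      x′ : Fin (length Vs) → ℕ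
      x′ k = χ (a ≡ᵇ k) + x k
      Σx′ : sumFin x′ ≡ suc (length Ss)
      Σx′ = trans (sumFin-+ (λ k → χ (a ≡ᵇ k)) x) (cong₂ _+_ (sumFin-χ≡ᵇ a) Σx)
      bound′ : ∀ j → absent cls (S ∩ ⋂ Ss) j ≤ deficitSum cls Vs x′ j
      bound′ j = begin
        absent cls (S ∩ ⋂ Ss) j                ≤⟨ absent-∩ cls S (⋂ Ss) j ⟩
        absent cls S j + absent cls (⋂ Ss) j   ≤⟨ +-mono-≤ (absent-antitone cls M⊆S j) (bound j) ⟩
        absent cls M j + deficitSum cls Vs x j ≡⟨ cong (_+ deficitSum cls Vs x j) absent-M≡d-a ⟩
        d a + deficitSum cls Vs x j            ≡⟨ sumFin-*-χ≡ᵇ-+ d x a ⟨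
        sumFin (λ k → d k * x′ k)              ∎
        where
        open ≤-Reasoning
        d : Fin (length Vs) → ℕ
        d k = deficit cls j (L.lookup Vs k)
        absent-M≡d-a : absent cls M j ≡ d a
        absent-M≡d-a =
          trans (sym (deficit-coalitionVector cls M j)) (cong (deficit cls j) (lookup-index v∈Vs))

    nakamuraFamily⇒feasible : ∀ {k} → NakamuraFamily W k →
      Σ (Fin (length Vs) → ℕ) λ x → Feasible cls Vs x × sumFin x ≡ k
    nakamuraFamily⇒feasible (Ss , Ss-win , empty , refl) with minimalVectorCounts Ss Ss-win
    ... | x , Σx≡ , bound = x , feasible , Σx≡
      where
      feasible : Feasible cls Vs x
      feasible j = subst (_≤ deficitSum cls Vs x j) (absent-Empty cls empty j) (bound j)

    feasible⇒nakamuraFamily : IsClassEnumeration W t cls → ∀ x → Feasible cls Vs x →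
      NakamuraFamily W (sumFin x)
    feasible⇒nakamuraFamily E x feasible =
      L.tabulate C , tabulate⁺ C-wins , C-disjoint , length-tabulate C
      where
      copy : Fin (sumFin x) → Fin (length Vs)
      copy = replicateIndex x
      v : Fin (sumFin x) → Vec ℕ t
      v l = L.lookup Vs (copy l)
      enough : ∀ j → count (λ i → cls i ≡ᵇ j) ≤ sumFin (λ l → deficit cls j (v l))
      enough j = subst₂ _≤_ (classSize≡count cls j)
                   (sym (sumFin-replicateIndex x (λ k → deficit cls j (L.lookup Vs k)))) (feasible j)
      assignment = assignWithinCapacity cls (λ l j → deficit cls j (v l)) enough
      h = proj₁ assignment
      C : Fin (sumFin x) → Subset n
      C l = tabulate (λ i → not (h i ≡ᵇ l))
      C-wins : ∀ l → Winning W (C l)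
      C-wins l = dominates (Equivalence.to (Vs-minimal (v l)) (∈-lookup (copy l)))
        where
        dominates : MinimalWinningVector W cls (v l) → Winning W (C l)
        dominates (S , (S-wins , _) , S-vector) = winning-dominated E S (C l) S-wins S≤C
          where
          vector≡present : ∀ c → lookup (v l) c ≡ present cls S c
          vector≡present c = trans (cong (λ u → lookup u c) (sym S-vector)) (coalitionVector≡present cls S c)
          ≤-by-complement : ∀ {A B N V} → N ≡ A + B → A ≤ N ∸ V → V ≤ N → V ≤ B
          ≤-by-complement {A} {B} {N} {V} N≡A+B A≤N∸V V≤N = begin
            V           ≡⟨ m∸[m∸n]≡n V≤N ⟨
            N ∸ (N ∸ V) ≤⟨ ∸-monoʳ-≤ N A≤N∸V ⟩
            N ∸ A       ≡⟨ cong (_∸ A) N≡A+B ⟩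
            A + B ∸ A   ≡⟨ m+n∸m≡n A B ⟩
            B           ∎
            where open ≤-Reasoning
          S≤C : ∀ c → present cls S c ≤ present cls (C l) c
          S≤C c = subst₂ _≤_ (vector≡present c) (sym (present-tabulate cls (λ i → not (h i ≡ᵇ l)) c))
            (≤-by-complement
              (trans (classSize≡count cls c) (count-split (λ i → h i ≡ᵇ l) (λ i → cls i ≡ᵇ c)))
              (proj₂ assignment l c)
              (subst (_≤ classSize cls c) (sym (vector≡present c)) (present≤classSize cls S c)))
      C-disjoint : Empty (⋂ (L.tabulate C))
      C-disjoint (i , i∈⋂C) = i∉C-hi (∈⇒lookup (tabulate⁻ (∈⋂⇒All (L.tabulate C) i∈⋂C) (h i)))
        where
        i∉C-hi : lookup (C (h i)) i ≢ true
        i∉C-hi C-hi[i]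
          with trans (sym C-hi[i]) (trans (lookup∘tabulate _ i) (cong not (≡ᵇ-refl (h i))))
        ... | ()

lemma6 : ∀ {n t : ℕ} (W : Subset n → Bool) (cls : Fin n → Fin t)
    → IsSimpleGame W
    → (∀ i → ¬ Vetoer W i)
    → IsClassEnumeration W t cls
    → (Vs : List (Vec ℕ t))
    → Unique Vs
    → (∀ v → (v ∈ Vs) ⇔ MinimalWinningVector W cls v)
    → Σ ℕ (λ k → IsNakamuraNumber W k × IsIPOptimum cls Vs k)
-- Repeated vectors in Vs would only split a variable.
lemma6 W cls G no-vetoer E Vs _ Vs-minimal =
  let ν , ν-family , ν-minimal = least (nakamuraFamily? W) (vetoless⇒nakamuraFamily W no-vetoer)
  in ν
   , (ν-family , λ Ss Ss-win empty → ν-minimal (length Ss) (Ss , Ss-win , empty , refl))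
   , (nakamuraFamily⇒feasible G cls Vs Vs-minimal ν-family
   , λ x feasible → ν-minimal (sumFin x) (feasible⇒nakamuraFamily G cls Vs Vs-minimal E x feasible))
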